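{- Let $f:M\to N$ and $g:N\to P$ be morphisms of proper partial epistemic frames over a finite nonempty set of agents $A$. Then $\sigma(g\circ f)=\sigma(g)\circ\sigma(f)$.
   Context: A partial epistemic frame over $A$ is $\langle W,\sim\rangle$ with each $\sim_a$ ($a\in A$) symmetric and transitive on $W$; $\mathrm{live}(w)=\{a\mid w\sim_a w\}$, $[w]_a$ is the $\sim_a$-class of $w$, and $\mathrm{sat}_U(w)=\{w'\mid w\sim_a w'\ \forall a\in U\}$. It is proper if for all $w,w'$ there is $a$ with $w\sim_a w$ and ($w\neq w'\Rightarrow w\not\sim_a w'$). A morphism $h:\langle W,\sim\rangle\to\langle W',\sim'\rangle$ is a function $h:W\to\mathcal{P}(W')$ such that $u\sim_a v$ implies $u'\sim'_a v'$ for all $u'\in h(u),v'\in h(v)$, and for every $u$ there is $u'\in h(u)$ with $h(u)=\mathrm{sat}_{\mathrm{live}(u)}(u')$. Composition: $(g\circ f)(u)=\mathrm{sat}_{\mathrm{live}(u)}(w)$ (in $P$) for any $v\in f(u)$, $w\in g(v)$. The chromatic simplicial complex $\sigma(M)$ has vertices $v^w_a=(a,[w]_a)$ for $w\in W$, $a\in\mathrm{live}(w)$, simplexes all nonempty subsets of $X_w=\{v^w_a\mid a\in\mathrm{live}(w)\}$, and colouring $\chi(v^w_a)=a$. For a morphism $f:M\to N$, the simplicial map $\sigma(f):\sigma(M)\to\sigma(N)$ sends $v^w_a$ to $v^{w'}_a$ for any $w'\in f(w)$ (this is independent of the choices). -}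

module Defs where

open import Level using (0ℓ)
open import Data.Nat using (ℕ; suc)
open import Data.Fin using (Fin)
open import Data.Product using (Σ; _×_; _,_; proj₁; proj₂; ∃)
open import Relation.Nullary using (¬_)
open import Relation.Binary.PropositionalEquality using (_≡_)
open import Function.Bundles using (_⇔_)

Agent : ℕ → Set
Agent n = Fin (suc n)

Pred : Set → Set₁
Pred X = X → Set

record Frame (n : ℕ) : Set₁ where
  field
    W     : Set
    R     : Agent n → W → W → Set          -- R a u v  means  u ∼ₐ v
    sym   : ∀ a {u v} → R a u v → R a v u
    trans : ∀ a {u v w} → R a u v → R a v w → R a u w

  live : W → Pred (Agent n)
  live w a = R a w w

  sat : Pred (Agent n) → W → Pred W
  sat U w w' = ∀ a → U a → R a w w'

open Frame public

Proper : ∀ {n} → Frame n → Set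
Proper M = ∀ (w w' : W M) → ∃ λ a → R M a w w × (¬ (w ≡ w') → ¬ R M a w w')

_≐_ : ∀ {X : Set} → Pred X → Pred X → Set
P ≐ Q = ∀ x → P x ⇔ Q x

-- Morphisms h : W → P(W').  The existential "there is u' ∈ h(u) with
-- h(u) = sat_{live(u)}(u')" is read constructively (a witness per u).
record Morphism {n} (M N : Frame n) : Set₁ where
  field
    map   : W M → Pred (W N)
    pres  : ∀ a {u v} → R M a u v → ∀ {u' v'} → map u u' → map v v' → R N a u' v'
    point : ∀ u → Σ (W N) λ u' → map u u' × (map u ≐ sat N (live M u) u')

open Morphism public

-- Composition: (g ∘ f)(u) = sat_{live(u)}(w) for any v ∈ f(u), w ∈ g(v).
-- (Encoded as: z ∈ (g∘f)(u) iff z ∈ sat_{live(u)}(w) for some such v, w;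
-- the paper asserts independence of the choice.)
compMap : ∀ {n} {M N P : Frame n} → Morphism N P → Morphism M N → W M → Pred (W P)
compMap {M = M} {P = P} g f u z =
  Σ _ λ v → map f u v × Σ _ λ w → map g v w × sat P (live M u) w z

-- Vertices of σ(M): v^w_a = (a, [w]_a) for a ∈ live(w), represented by the pair (a , w).
VRep : ∀ {n} → Frame n → Set
VRep {n} M = Agent n × W M

IsVertex : ∀ {n} (M : Frame n) → VRep M → Set
IsVertex M (a , w) = live M w a

VEq : ∀ {n} (M : Frame n) → VRep M → VRep M → Set
VEq M (a , w) (a' , w') = a ≡ a' × ((λ x → R M a w x) ≐ (λ x → R M a w' x))

-- Graph of the vertex map σ(h): σ(h) sends v^w_a to v^{w'}_a for (any) w' ∈ h(w).
-- σ[ h ] x ↦ y  means  y (as a vertex) is the image of x.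
σ⟨_,_⟩[_]_↦_ : ∀ {n} (M N : Frame n) → (W M → Pred (W N)) → VRep M → VRep N → Set
σ⟨ M , N ⟩[ h ] (a , w) ↦ y = Σ (W N) λ w' → h w w' × VEq N y (a , w')

module Submission where

-- Every vertex in the statement is coloured by the agent a of x = (a , w), and a is live at w.
-- Morphisms preserve ∼ₐ, so all the candidate images (through f then g, or through the
-- composite) lie in one ∼ₐ-class of P, and their vertices (a , [_]ₐ) therefore coincide.

open import Defs
open import Data.Nat using (ℕ)
open import Data.Product using (_,_)
open import Relation.Binary.PropositionalEquality using (refl)
open import Function.Bundles using (mk⇔; Equivalence)
open import Function.Properties.Equivalence using () renaming (sym to ⇔-sym; trans to ⇔-trans)

module _ {X : Set} where

  ≐-sym : {A B : Pred X} → A ≐ B → B ≐ A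
  ≐-sym A≐B x = ⇔-sym (A≐B x)

  ≐-trans : {A B C : Pred X} → A ≐ B → B ≐ C → A ≐ C
  ≐-trans A≐B B≐C x = ⇔-trans (A≐B x) (B≐C x)

module _ {n : ℕ} (M : Frame n) where

  related⇒class≐ : ∀ a {u v} → R M a u v → (λ x → R M a u x) ≐ (λ x → R M a v x)
  related⇒class≐ a uv x = mk⇔ (trans M a (sym M a uv)) (trans M a uv)

  class≐⇒related : ∀ a {u v} → (λ x → R M a u x) ≐ (λ x → R M a v x) → live M v a → R M a v u
  class≐⇒related a {v = v} u≐v va = sym M a (Equivalence.from (u≐v v) va)

  related⇒VEq : ∀ a {u v} → R M a u v → VEq M (a , u) (a , v)
  related⇒VEq a uv = refl , related⇒class≐ a uv

  VEq-sym : ∀ {x y} → VEq M x y → VEq M y x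
  VEq-sym (refl , x≐y) = refl , ≐-sym x≐y

  VEq-trans : ∀ {x y z} → VEq M x y → VEq M y z → VEq M x z
  VEq-trans (refl , x≐y) (refl , y≐z) = refl , ≐-trans x≐y y≐z

module _ {n : ℕ} {M N P : Frame n} (f : Morphism M N) (g : Morphism N P) where

  compMap-related : ∀ {a u v v' w z} → live M u a → map f u v → R N a v v' →
                    map g v' w → compMap g f u z → R P a w z
  compMap-related {a} {v' = v'} {w = w} ua fv vv' gw (v₀ , fv₀ , w₀ , gw₀ , sat-w₀-z) =
    trans P a (sym P a w₀w) (sat-w₀-z a ua)
    where
      v₀v' : R N a v₀ v'
      v₀v' = trans N a (pres f a ua fv₀ fv) vv'

      w₀w : R P a w₀ w
      w₀w = pres g a v₀v' gw₀ gw

proposition24 : ∀ {n : ℕ} {M N P : Frame n} → Proper M → Proper N → Proper P →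
    (f : Morphism M N) (g : Morphism N P) →
    ∀ (x : VRep M) → IsVertex M x →
    ∀ (y : VRep N) (z z' : VRep P) →
    σ⟨ M , N ⟩[ map f ] x ↦ y → σ⟨ N , P ⟩[ map g ] y ↦ z → σ⟨ M , P ⟩[ compMap g f ] x ↦ z' →
    VEq P z z'
proposition24 {N = N} {P = P} _ _ _ f g (a , w) wa (.a , u) z z'
  (v , fv , refl , u≐v) (t , gt , z≈t) (s , gfs , z'≈s) =
  VEq-trans P z≈t (VEq-trans P (related⇒VEq P a ts) (VEq-sym P z'≈s))
  where
    vu : R N a v u
    vu = class≐⇒related N a u≐v (pres f a wa fv fv)

    ts : R P a t s
    ts = compMap-related f g wa fv vu gt gfs
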